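{- Let $H$ be a finite abelian group and $n$ a positive integer. There exists $\phi\in X_0(\mathbb{Z})$ with $\phi\equiv\mathbb{1}\bmod n$ if and only if $C_0(H)$ contains an element of order $n$.
   Context: Let $L$ be a number field containing all character values of $H$. For $R=\mathbb{Z}$ or $L$, $X(R)$ is the set of $R$-valued class functions (i.e. functions) on $H$, with the usual inner product on $X(L)$. $\mathbb{1}$ is the trivial character; $X(L)=X_{\mathbb{1}}(L)\oplus X_0(L)$ with $X_{\mathbb{1}}(L)=L\mathbb{1}$ and $X_0(L)$ its orthogonal complement; $X_{\mathbb{1}}(\mathbb{Z})=\mathbb{Z}\mathbb{1}$ and $X_0(\mathbb{Z})=X_0(L)\cap X(\mathbb{Z})$. The congruence module is $C_0(H)=X(\mathbb{Z})/(X_{\mathbb{1}}(\mathbb{Z})\oplus X_0(\mathbb{Z}))$. $\phi\equiv\mathbb{1}\bmod n$ means $\phi(h)\equiv1\bmod n$ for all $h\in H$. -}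

module Defs where

open import Level using (0ℓ)
open import Data.Nat as ℕ using (ℕ; zero; suc)
open import Data.Fin using (Fin)
import Data.Fin as Fin
open import Data.Integer using (ℤ; +_; _+_; _-_; _*_; 0ℤ; 1ℤ)
open import Data.Integer.Divisibility using (_∣_)
open import Data.Product using (Σ; ∃; ∃-syntax; _×_)
open import Relation.Nullary using (¬_)
open import Relation.Binary.PropositionalEquality using (_≡_)
import Relation.Binary.PropositionalEquality as ≡
open import Algebra.Bundles using (AbelianGroup)
open import Function.Bundles using (Bijection)

record FiniteAbelianGroup : Set₁ where
  field
    group : AbelianGroup 0ℓ 0ℓ
    order : ℕ
    enum  : Bijection (≡.setoid (Fin order)) (AbelianGroup.setoid group)
  open AbelianGroup group public using (Carrier; _≈_)
  open Bijection enum public using (to)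

module _ (H : FiniteAbelianGroup) where
  open FiniteAbelianGroup H

  -- X(ℤ): ℤ-valued class functions on H (H abelian, so all functions
  -- respecting the group's equality).
  record ClassFn : Set where
    constructor classFn
    field
      fun  : Carrier → ℤ
      resp : ∀ {x y} → x ≈ y → fun x ≡ fun y
  open ClassFn public

  sumFin : (m : ℕ) → (Fin m → ℤ) → ℤ
  sumFin zero    f = 0ℤ
  sumFin (suc m) f = f Fin.zero + sumFin m (λ i → f (Fin.suc i))

  sumH : ClassFn → ℤ
  sumH φ = sumFin order (λ i → fun φ (to i))

  -- X₀(ℤ): integer class functions orthogonal to the trivial character 𝟙,
  -- i.e. ⟨φ, 𝟙⟩ = |H|⁻¹ Σ_h φ(h) = 0, i.e. Σ_h φ(h) = 0.
  InX0 : ClassFn → Set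
  InX0 φ = sumH φ ≡ 0ℤ

  InSub : ClassFn → Set
  InSub ψ = ∃[ c ] ∃[ φ ] (InX0 φ × (∀ h → fun ψ h ≡ c + fun φ h))

  scale : ℕ → ClassFn → ClassFn
  scale k ψ = classFn (λ h → + k * fun ψ h) (λ x≈y → ≡.cong (+ k *_) (resp ψ x≈y))

  -- the class [ψ] ∈ C₀(H) = X(ℤ)/(X_𝟙(ℤ) ⊕ X₀(ℤ)) has order exactly n
  HasOrderC0 : ClassFn → ℕ → Set
  HasOrderC0 ψ n = InSub (scale n ψ) × (∀ k → 1 ℕ.≤ k → k ℕ.< n → ¬ InSub (scale k ψ))

  C0HasElementOfOrder : ℕ → Set
  C0HasElementOfOrder n = ∃[ ψ ] HasOrderC0 ψ n

  CongOneMod : ClassFn → ℕ → Set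
  CongOneMod φ n = ∀ h → (+ n) ∣ (fun φ h - 1ℤ)

{-# OPTIONS --safe #-}
-- Both conditions say that n divides |H|.  Summation ψ ↦ Σ_h ψ(h) maps X(ℤ)
-- onto ℤ and sends X_𝟙(ℤ) ⊕ X₀(ℤ) = {ψ | Σ ψ ∈ |H|ℤ} onto |H|ℤ, so it
-- identifies C₀(H) with ℤ/|H|ℤ, which has an element of order n iff n ∣ |H|.
-- If φ ∈ X₀(ℤ) and φ ≡ 𝟙 mod n, then n divides Σ_h (φ(h) - 1) = -|H|;
-- conversely, if n ∣ |H|, the function that is 1 - |H| at one point and 1
-- elsewhere lies in X₀(ℤ) and is ≡ 𝟙 mod n.
module Submission where

open import Defs
open import Data.Nat using (ℕ; _≤_)
open import Data.Product using (∃-syntax; _×_; _,_; proj₁; proj₂)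
open import Function.Bundles using (_⇔_; Bijection; Equivalence; mk⇔)

import Data.Nat as ℕ
import Data.Nat.Properties as ℕ
import Data.Nat.Divisibility as ℕ
open import Data.Nat.DivMod using (_%_; _/_; m≡m%n+[m/n]*n; m%n<n)
open import Data.Fin using (Fin; zero; suc)
open import Data.Fin.Properties using (nonZeroIndex)
open import Function.Base using (_∘_)
open import Data.Integer using (ℤ; +_; _+_; _-_; _*_; -_; 0ℤ; 1ℤ)
import Data.Integer.Properties as ℤ
open import Data.Integer.Divisibility.Signed
  using (_∣_; divides; ∣-refl; ∣-reflexive; ∣m∣n⇒∣m+n; ∣m∣n⇒∣m-n; ∣m⇒∣-m; ∣m⇒∣m*n; ∣n⇒∣m*n; ∣ᵤ⇒∣; ∣⇒∣ᵤ)
open import Data.Integer.Tactic.RingSolver using (solve-∀)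
open import Relation.Binary.PropositionalEquality
  using (_≡_; refl; sym; trans; cong; cong₂; subst; subst₂; module ≡-Reasoning)
open import Relation.Nullary using (¬_; yes; no; contradiction)
open import Function.Construct.Symmetry using (⇔-sym)
open import Function.Construct.Composition using (_⇔-∘_)
open import Algebra.Bundles using (AbelianGroup)
open import Algebra.Properties.CommutativeSemigroup ℤ.+-commutativeSemigroup
  using () renaming (interchange to +-interchange)

HasOrderMod : ℕ → ℤ → ℕ → Set
HasOrderMod N s n = (+ N ∣ + n * s) × (∀ k → 1 ≤ k → k ℕ.< n → ¬ (+ N ∣ + k * s))

hasOrderMod⇒∣ : ∀ {N s n} → 1 ≤ n → HasOrderMod N s n → n ℕ.∣ N
hasOrderMod⇒∣ {N} {s} {n@(ℕ.suc _)} _ (N∣ns , minimal) with N % n ℕ.≟ 0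
... | yes r≡0 = ℕ.m%n≡0⇒n∣m N n r≡0
... | no  r≢0 = contradiction N∣rs (minimal r (ℕ.n≢0⇒n>0 r≢0) (m%n<n N n))
  where
  r = N % n
  q = N / n
  -- r s = N s - q (n s) is a multiple of N, so minimality of n forces r = 0.
  N≡r+qn : + N ≡ + r + + q * + n
  N≡r+qn = begin
    + N               ≡⟨ cong +_ (m≡m%n+[m/n]*n N n) ⟩
    + (r ℕ.+ q ℕ.* n) ≡⟨ ℤ.pos-+ r (q ℕ.* n) ⟩
    + r + + (q ℕ.* n) ≡⟨ cong (_+_ (+ r)) (ℤ.pos-* q n) ⟩
    + r + + q * + n   ∎
    where open ≡-Reasoning
  rs≡Ns-qns : + N * s - + q * (+ n * s) ≡ + r * s
  rs≡Ns-qns = begin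
    + N * s - + q * (+ n * s)                 ≡⟨ cong (λ x → x * s - + q * (+ n * s)) N≡r+qn ⟩
    (+ r + + q * + n) * s - + q * (+ n * s)   ≡⟨ cancel (+ r) (+ q) (+ n) s ⟩
    + r * s ∎
    where
    open ≡-Reasoning
    cancel : ∀ r q n s → (r + q * n) * s - q * (n * s) ≡ r * s
    cancel = solve-∀
  N∣rs : + N ∣ + r * s
  N∣rs = subst (+ N ∣_) rs≡Ns-qns (∣m∣n⇒∣m-n (∣m⇒∣m*n s ∣-refl) (∣n⇒∣m*n (+ q) N∣ns))

quotient-hasOrderMod : ∀ d n .{{_ : ℕ.NonZero d}} → HasOrderMod (d ℕ.* n) (+ d) n
quotient-hasOrderMod d n = ∣-reflexive dn≡nd , minimal
  where
  dn≡nd : + (d ℕ.* n) ≡ + n * + d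
  dn≡nd = trans (cong +_ (ℕ.*-comm d n)) (ℤ.pos-* n d)
  minimal : ∀ k → 1 ≤ k → k ℕ.< n → ¬ (+ (d ℕ.* n) ∣ + k * + d)
  minimal k@(ℕ.suc _) _ k<n dn∣kd = ℕ.<⇒≱ k<n (ℕ.∣⇒≤ n∣k)
    where
    n∣k : n ℕ.∣ k
    n∣k = ℕ.*-cancelˡ-∣ d (subst (d ℕ.* n ℕ.∣_) (trans (ℤ.abs-* (+ k) (+ d)) (ℕ.*-comm k d)) (∣⇒∣ᵤ dn∣kd))

spike : ∀ {m} → ℤ → ℤ → Fin m → ℤ
spike a b zero    = a
spike a b (suc _) = b

spike-≡1-mod : ∀ {m n} → n ℕ.∣ m → ∀ (i : Fin m) → + n ∣ spike (1ℤ - + m) 1ℤ i - 1ℤ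
spike-≡1-mod {m} n∣m zero    = subst (+ _ ∣_) (-m≡1-m-1 (+ m)) (∣m⇒∣-m (∣ᵤ⇒∣ n∣m))
  where
  -m≡1-m-1 : ∀ m → - m ≡ (1ℤ - m) - 1ℤ
  -m≡1-m-1 = solve-∀
spike-≡1-mod {m} n∣m (suc _) = ∣ᵤ⇒∣ (_ ℕ.∣0)

module _ (H : FiniteAbelianGroup) where
  open FiniteAbelianGroup H
  private
    module G = AbelianGroup group
    module E = Bijection enum

  sumFin-cong : ∀ m {f g : Fin m → ℤ} → (∀ i → f i ≡ g i) → sumFin H m f ≡ sumFin H m g
  sumFin-cong ℕ.zero    f≗g = refl
  sumFin-cong (ℕ.suc m) f≗g = cong₂ _+_ (f≗g zero) (sumFin-cong m (f≗g ∘ suc))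

  sumFin-+ : ∀ m (f g : Fin m → ℤ) → sumFin H m (λ i → f i + g i) ≡ sumFin H m f + sumFin H m g
  sumFin-+ ℕ.zero    f g = refl
  sumFin-+ (ℕ.suc m) f g = begin
    f zero + g zero + sumFin H m (λ i → f (suc i) + g (suc i))
      ≡⟨ cong (_+_ (f zero + g zero)) (sumFin-+ m (f ∘ suc) (g ∘ suc)) ⟩
    f zero + g zero + (sumFin H m (f ∘ suc) + sumFin H m (g ∘ suc))
      ≡⟨ +-interchange (f zero) (g zero) _ _ ⟩
    f zero + sumFin H m (f ∘ suc) + (g zero + sumFin H m (g ∘ suc)) ∎
    where open ≡-Reasoning

  *-distribˡ-sumFin : ∀ m c (f : Fin m → ℤ) → sumFin H m (λ i → c * f i) ≡ c * sumFin H m f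
  *-distribˡ-sumFin ℕ.zero    c f = sym (ℤ.*-zeroʳ c)
  *-distribˡ-sumFin (ℕ.suc m) c f =
    trans (cong (_+_ (c * f zero)) (*-distribˡ-sumFin m c (f ∘ suc))) (sym (ℤ.*-distribˡ-+ c _ _))

  sumFin-const : ∀ m c → sumFin H m (λ _ → c) ≡ + m * c
  sumFin-const ℕ.zero    c = refl
  sumFin-const (ℕ.suc m) c = trans (cong (_+_ c) (sumFin-const m c)) (sym (ℤ.suc-* (+ m) c))

  sumFin-spike : ∀ m .{{_ : ℕ.NonZero m}} a b → sumFin H m (spike a b) ≡ a + (+ m - 1ℤ) * b
  sumFin-spike (ℕ.suc m) a b = cong (_+_ a) (sumFin-const m b)

  ∣-sumFin : ∀ m {k} (f : Fin m → ℤ) → (∀ i → k ∣ f i) → k ∣ sumFin H m f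
  ∣-sumFin ℕ.zero    f k∣f = ∣ᵤ⇒∣ (_ ℕ.∣0)
  ∣-sumFin (ℕ.suc m) f k∣f = ∣m∣n⇒∣m+n (k∣f zero) (∣-sumFin m (f ∘ suc) (k∣f ∘ suc))

  index : Carrier → Fin order
  index h = proj₁ (E.strictlySurjective h)

  index-resp : ∀ {x y} → x ≈ y → index x ≡ index y
  index-resp {x} {y} x≈y = E.injective
    (G.trans (proj₂ (E.strictlySurjective x)) (G.trans x≈y (G.sym (proj₂ (E.strictlySurjective y)))))

  index-to : ∀ i → index (to i) ≡ i
  index-to i = E.injective (proj₂ (E.strictlySurjective (to i)))

  instance
    order-nonZero : ℕ.NonZero order
    order-nonZero = nonZeroIndex (index G.ε)

  indexed : (Fin order → ℤ) → ClassFn H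
  indexed f = classFn (f ∘ index) (cong f ∘ index-resp)

  sumH-indexed : ∀ f → sumH H (indexed f) ≡ sumFin H order f
  sumH-indexed f = sumFin-cong order (cong f ∘ index-to)

  sumH-scale : ∀ k ψ → sumH H (scale H k ψ) ≡ + k * sumH H ψ
  sumH-scale k ψ = *-distribˡ-sumFin order (+ k) _

  inSub⇔order∣sumH : ∀ ψ → InSub H ψ ⇔ + order ∣ sumH H ψ
  inSub⇔order∣sumH ψ = mk⇔ toDivides fromDivides
    where
    toDivides : InSub H ψ → + order ∣ sumH H ψ
    toDivides (c , φ , Σφ≡0 , ψ≡c+φ) = divides c (begin
      sumH H ψ                                ≡⟨ sumFin-cong order (ψ≡c+φ ∘ to) ⟩
      sumFin H order (λ i → c + fun φ (to i)) ≡⟨ sumFin-+ order _ _ ⟩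
      sumFin H order (λ _ → c) + sumH H φ     ≡⟨ cong₂ _+_ (sumFin-const order c) Σφ≡0 ⟩
      + order * c + 0ℤ                        ≡⟨ ℤ.+-identityʳ _ ⟩
      + order * c                             ≡⟨ ℤ.*-comm (+ order) c ⟩
      c * + order ∎)
      where open ≡-Reasoning
    fromDivides : + order ∣ sumH H ψ → InSub H ψ
    fromDivides (divides c Σψ≡cN) = c , φ , Σφ≡0 , λ h → ψ≡c+[ψ-c] (fun ψ h) c
      where
      ψ≡c+[ψ-c] : ∀ x c → x ≡ c + (x - c)
      ψ≡c+[ψ-c] = solve-∀
      φ : ClassFn H
      φ = classFn (λ h → fun ψ h - c) (cong (_- c) ∘ resp ψ)
      Σφ≡0 : InX0 H φ
      Σφ≡0 = begin
        sumH H φ                                   ≡⟨ sumFin-+ order _ _ ⟩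
        sumH H ψ + sumFin H order (λ _ → - c)      ≡⟨ cong₂ _+_ Σψ≡cN (sumFin-const order (- c)) ⟩
        c * + order + + order * - c                ≡⟨ cancel c (+ order) ⟩
        0ℤ ∎
        where
        open ≡-Reasoning
        cancel : ∀ c N → c * N + N * - c ≡ 0ℤ
        cancel = solve-∀

  hasOrderC0⇔hasOrderMod : ∀ ψ n → HasOrderC0 H ψ n ⇔ HasOrderMod order (sumH H ψ) n
  hasOrderC0⇔hasOrderMod ψ n = mk⇔
    (λ (top , minimal) → Equivalence.to (inSub-scale n) top ,
                         λ k 1≤k k<n → minimal k 1≤k k<n ∘ Equivalence.from (inSub-scale k))
    (λ (top , minimal) → Equivalence.from (inSub-scale n) top ,
                         λ k 1≤k k<n → minimal k 1≤k k<n ∘ Equivalence.to (inSub-scale k))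
    where
    inSub-scale : ∀ k → InSub H (scale H k ψ) ⇔ + order ∣ + k * sumH H ψ
    inSub-scale k = subst (λ s → InSub H (scale H k ψ) ⇔ + order ∣ s) (sumH-scale k ψ)
                          (inSub⇔order∣sumH (scale H k ψ))

  c0HasElementOfOrder⇔∣order : ∀ {n} → 1 ≤ n → C0HasElementOfOrder H n ⇔ n ℕ.∣ order
  c0HasElementOfOrder⇔∣order {n} 1≤n = mk⇔
    (λ (ψ , ord) → hasOrderMod⇒∣ 1≤n (Equivalence.to (hasOrderC0⇔hasOrderMod ψ n) ord))
    elementOfOrder
    where
    elementOfOrder : n ℕ.∣ order → C0HasElementOfOrder H n
    elementOfOrder (ℕ.divides d order≡dn) = ψ , Equivalence.from (hasOrderC0⇔hasOrderMod ψ n)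
      (subst₂ (λ N s → HasOrderMod N s n) (sym order≡dn) (sym Σψ≡d) (quotient-hasOrderMod d n))
      where
      instance
        d-nonZero : ℕ.NonZero d
        d-nonZero = ℕ.m*n≢0⇒m≢0 d {{subst ℕ.NonZero order≡dn order-nonZero}}
      ψ : ClassFn H
      ψ = indexed (spike (+ d) 0ℤ)
      Σψ≡d : sumH H ψ ≡ + d
      Σψ≡d = trans (sumH-indexed _) (trans (sumFin-spike order (+ d) 0ℤ) (a+x*0≡a (+ d) (+ order - 1ℤ)))
        where
        a+x*0≡a : ∀ a x → a + x * 0ℤ ≡ a
        a+x*0≡a = solve-∀

  x0CongOne⇔∣order : ∀ {n} → (∃[ φ ] (InX0 H φ × CongOneMod H φ n)) ⇔ n ℕ.∣ order
  x0CongOne⇔∣order {n} = mk⇔ ∣order congOne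
    where
    ∣order : ∃[ φ ] (InX0 H φ × CongOneMod H φ n) → n ℕ.∣ order
    ∣order (φ , Σφ≡0 , φ≡1) = subst (n ℕ.∣_) (ℤ.∣-i∣≡∣i∣ (+ order))
      (∣⇒∣ᵤ (subst (+ n ∣_) Σ[φ-1]≡-N (∣-sumFin order _ (∣ᵤ⇒∣ ∘ φ≡1 ∘ to))))
      where
      Σ[φ-1]≡-N : sumFin H order (λ i → fun φ (to i) - 1ℤ) ≡ - + order
      Σ[φ-1]≡-N = begin
        sumFin H order (λ i → fun φ (to i) - 1ℤ)   ≡⟨ sumFin-+ order _ _ ⟩
        sumH H φ + sumFin H order (λ _ → - 1ℤ)     ≡⟨ cong₂ _+_ Σφ≡0 (sumFin-const order (- 1ℤ)) ⟩
        0ℤ + + order * - 1ℤ                        ≡⟨ 0+N*-1≡-N (+ order) ⟩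
        - + order ∎
        where
        open ≡-Reasoning
        0+N*-1≡-N : ∀ N → 0ℤ + N * - 1ℤ ≡ - N
        0+N*-1≡-N = solve-∀
    congOne : n ℕ.∣ order → ∃[ φ ] (InX0 H φ × CongOneMod H φ n)
    congOne n∣N = indexed (spike (1ℤ - + order) 1ℤ) , Σφ≡0 , ∣⇒∣ᵤ ∘ spike-≡1-mod n∣N ∘ index
      where
      Σφ≡0 : sumH H (indexed (spike (1ℤ - + order) 1ℤ)) ≡ 0ℤ
      Σφ≡0 = trans (sumH-indexed _) (trans (sumFin-spike order _ _) (cancel (+ order)))
        where
        cancel : ∀ N → (1ℤ - N) + (N - 1ℤ) * 1ℤ ≡ 0ℤ
        cancel = solve-∀

lemma5p4 : (H : FiniteAbelianGroup) (n : ℕ) → 1 ≤ n →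
    (∃[ φ ] (InX0 H φ × CongOneMod H φ n)) ⇔ C0HasElementOfOrder H n
lemma5p4 H n 1≤n = ⇔-sym (c0HasElementOfOrder⇔∣order H 1≤n) ⇔-∘ x0CongOne⇔∣order H
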